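{- For every integer $n\geq 0$ and indeterminate $y$, $$\sum_{k=0}^{n}(-1)^{n-k}\binom{n}{k}A_{n,k}B_{k+1}(y)=y\sum_{k=0}^{n}\binom{n}{k}B_{k}B_k(y),$$ $$\sum_{k=0}^{n}(-1)^{n-k}\binom{n}{k}B_{k}B_{k+1}(y)=y\sum_{k=0}^{n}\binom{n}{k}A_{n,k}B_{k}(y).$$
   Context: A partition of a finite set is a collection of nonempty, pairwise disjoint subsets (blocks) whose union is the set; a singleton of a partition is a block with exactly one element. $B_n$ denotes the $n$-th Bell number ($B_0=1$), and $B_k(y)=\sum_{j=0}^{k}S(k,j)y^j$ is the $k$-th Bell polynomial, where $S(k,j)$ are Stirling numbers of the second kind. For integers $0\leq k\leq n$, $A_{n,k}$ denotes the number of partitions of $\{1,2,\dots,n+1\}$ whose largest singleton is $k+1$ (i.e. $\{k+1\}$ is a block and no $j>k+1$ forms a singleton block). -}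

module Defs where

open import Data.Nat using (ℕ; zero; suc; _≡ᵇ_; _<ᵇ_; _∸_)
open import Data.Bool using (Bool; true; false; if_then_else_; _∧_; not)
open import Data.List using (List; []; _∷_; map; concatMap; upTo; length)
open import Data.Nat.Combinatorics using (_C_)
open import Data.Integer as ℤ using (ℤ; +_)
open import Relation.Binary.PropositionalEquality using (_≡_)

-- Set partitions of {0,…,m-1} (= {1,…,m} shifted by one), encoded as
-- restricted growth strings: the i-th entry is the label of the block
-- containing element i, blocks being labelled 0,1,2,… in order of their
-- least elements.  This is the standard bijective encoding of set
-- partitions; 'rgs m b' lists all such strings of length m where b
-- labels have already been used.

rgs : ℕ → ℕ → List (List ℕ)
rgs zero    b = [] ∷ []
rgs (suc m) b =
  concatMap (λ l → map (l ∷_) (rgs m (if l ≡ᵇ b then suc b else b))) (upTo (suc b))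

Partitions : ℕ → List (List ℕ)
Partitions m = rgs m 0

countB : {A : Set} → (A → Bool) → List A → ℕ
countB p []       = 0
countB p (x ∷ xs) = if p x then suc (countB p xs) else countB p xs

-- label of element i (default 0 out of range; only used in range)
labelOf : List ℕ → ℕ → ℕ
labelOf []       i       = 0
labelOf (x ∷ xs) zero    = x
labelOf (x ∷ xs) (suc i) = labelOf xs i

isSingleton : List ℕ → ℕ → Bool
isSingleton v i = (i <ᵇ length v) ∧ (countB (λ x → x ≡ᵇ labelOf v i) v ≡ᵇ 1)

largestSingletonIs : List ℕ → ℕ → Bool
largestSingletonIs v k =
  isSingleton v k ∧
  (countB (λ j → (k <ᵇ j) ∧ isSingleton v j) (upTo (length v)) ≡ᵇ 0)

-- A n k : number of partitions of {1,…,n+1} whose largest singleton is k+1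
-- (0-based: element k of {0,…,n}).
A : ℕ → ℕ → ℕ
A n k = countB (λ v → largestSingletonIs v k) (Partitions (suc n))

Bell : ℕ → ℕ
Bell n = length (Partitions n)

S : ℕ → ℕ → ℕ
S zero    zero    = 1
S zero    (suc j) = 0
S (suc k) zero    = 0
S (suc k) (suc j) = suc j Data.Nat.* S k (suc j) Data.Nat.+ S k j

-- Polynomials in y over ℤ, represented by their coefficient sequences
-- (coefficient of y^j at index j); equality is coefficientwise.

Poly : Set
Poly = ℕ → ℤ

_≈P_ : Poly → Poly → Set
p ≈P q = ∀ j → p j ≡ q j

yTimes : Poly → Poly
yTimes p zero    = + 0
yTimes p (suc j) = p j

scale : ℤ → Poly → Poly
scale c p j = c ℤ.* p j

sumP : ℕ → (ℕ → Poly) → Poly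
sumP zero    f j = f 0 j
sumP (suc n) f j = sumP n f j ℤ.+ f (suc n) j

BellPoly : ℕ → Poly
BellPoly k j = + S k j

sgn : ℕ → ℤ
sgn m = (ℤ.- (+ 1)) ℤ.^ m

{-# OPTIONS --safe #-}
-- Let D(i,m) = A(i+m,i), the number of partitions of {1,…,i+m+1} in which i+1 is a singleton and
-- none of the last m elements is. Counting partitions as restricted growth strings, letter by letter,
-- gives D(i,0) = B_i and D(i+1,m) = D(i,m) + D(i,m+1), so D is the difference table of the Bell
-- numbers: Δ^m B(i) = D(i,m) and, reading the table the other way,
-- Σ_t (-1)^(m-t) C(m,t) D(i+t,m-t) = D(i,0) = B_i.
-- By trinomial revision Σ_k (-1)^(n-k) C(n,k) x_k C(k,i) = C(n,i) Δ^(n-i) x(i), so these two facts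
-- say that C(n,k) A(n,k) and C(n,k) B_k are signed binomial transforms of each other, and both
-- identities follow from B_{k+1}(y) = y Σ_i C(k,i) B_i(y), i.e. S(k+1,j+1) = Σ_i C(k,i) S(i,j).
module Submission where

module Binomial where

  open import Data.Nat using (zero; suc; _+_; _*_; z≤n; s≤s)
  open import Data.Nat.Properties
  open import Data.Nat.Combinatorics using (_C_; nC1≡n; nCk+nC[k+1]≡[n+1]C[k+1]; k>n⇒nCk≡0)
  open import Data.Nat.Tactic.RingSolver using (solve-∀)
  open import Relation.Binary.PropositionalEquality
  open ≡-Reasoning

  pascal : ∀ n k → suc n C suc k ≡ n C k + n C suc k
  pascal n k = sym (nCk+nC[k+1]≡[n+1]C[k+1] n k)

  absorption : ∀ n k → suc k * (suc n C suc k) ≡ suc n * (n C k)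
  absorption n zero = trans (*-identityˡ (suc n C 1)) (trans (nC1≡n (suc n)) (sym (*-identityʳ (suc n))))
  absorption zero (suc k)
    rewrite k>n⇒nCk≡0 {1} {suc (suc k)} (s≤s (s≤s z≤n)) | k>n⇒nCk≡0 {0} {suc k} (s≤s z≤n)
      = *-zeroʳ (suc (suc k))
  absorption (suc n) (suc k) = begin
    suc (suc k) * (suc (suc n) C suc (suc k))
      ≡⟨ cong (suc (suc k) *_) (pascal (suc n) (suc k)) ⟩
    suc (suc k) * (x + y)
      ≡⟨ regroupˡ (suc k) x y ⟩
    x + suc k * x + suc (suc k) * y
      ≡⟨ cong₂ (λ p q → x + p + q) (absorption n k) (absorption n (suc k)) ⟩
    x + suc n * (n C k) + suc n * (n C suc k)
      ≡⟨ regroupʳ (suc n) x (n C k) (n C suc k) ⟩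
    x + suc n * (n C k + n C suc k)
      ≡⟨ cong (λ z → x + suc n * z) (sym (pascal n k)) ⟩
    suc (suc n) * x ∎
    where
      x = suc n C suc k
      y = suc n C suc (suc k)
      regroupˡ : ∀ k x y → suc k * (x + y) ≡ x + k * x + suc k * y
      regroupˡ = solve-∀
      regroupʳ : ∀ n x a c → x + n * a + n * c ≡ x + n * (a + c)
      regroupʳ = solve-∀

  trinomial-revision : ∀ i m t → ((i + m) C (i + t)) * ((i + t) C i) ≡ ((i + m) C i) * (m C t)
  trinomial-revision zero    m t = trans (*-identityʳ (m C t)) (sym (*-identityˡ (m C t)))
  trinomial-revision (suc i) m t = *-cancelˡ-≡ _ _ (suc i) (begin
    suc i * (P * Q)
      ≡⟨ x∙yz≈y∙xz (suc i) P Q ⟩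
    P * (suc i * Q)
      ≡⟨ cong (P *_) (absorption (i + t) i) ⟩
    P * (suc (i + t) * ((i + t) C i))
      ≡⟨ x∙yz≈y∙xz P (suc (i + t)) ((i + t) C i) ⟩
    suc (i + t) * (P * ((i + t) C i))
      ≡⟨ sym (*-assoc (suc (i + t)) P _) ⟩
    suc (i + t) * P * ((i + t) C i)
      ≡⟨ cong (_* ((i + t) C i)) (absorption (i + m) (i + t)) ⟩
    suc (i + m) * ((i + m) C (i + t)) * ((i + t) C i)
      ≡⟨ *-assoc (suc (i + m)) ((i + m) C (i + t)) ((i + t) C i) ⟩
    suc (i + m) * (((i + m) C (i + t)) * ((i + t) C i))
      ≡⟨ cong (suc (i + m) *_) (trinomial-revision i m t) ⟩
    suc (i + m) * (((i + m) C i) * (m C t))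
      ≡⟨ sym (*-assoc (suc (i + m)) ((i + m) C i) (m C t)) ⟩
    suc (i + m) * ((i + m) C i) * (m C t)
      ≡⟨ cong (_* (m C t)) (sym (absorption (i + m) i)) ⟩
    suc i * (suc (i + m) C suc i) * (m C t)
      ≡⟨ *-assoc (suc i) (suc (i + m) C suc i) (m C t) ⟩
    suc i * ((suc (i + m) C suc i) * (m C t)) ∎)
    where
      P = suc (i + m) C suc (i + t)
      Q = suc (i + t) C suc i
      x∙yz≈y∙xz : ∀ a b c → a * (b * c) ≡ b * (a * c)
      x∙yz≈y∙xz = solve-∀

module Transforms where

  open import Defs using (S; sgn; sumP; scale; yTimes; BellPoly; _≈P_)
  open import Data.Nat as ℕ using (ℕ; zero; suc; _∸_; _≤_; _<_; z≤n; s≤s)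
  import Data.Nat.Properties as ℕₚ
  open import Data.Nat.Combinatorics using (_C_; k>n⇒nCk≡0)
  open import Data.Integer using (ℤ; +_; -_; _+_; _-_; _*_)
  import Data.Integer.Properties as ℤₚ
  open import Data.Integer.Tactic.RingSolver using (solve-∀)
  open Binomial using (pascal; trinomial-revision)
  open import Relation.Binary.PropositionalEquality
  open ≡-Reasoning

  ∑ : ℕ → (ℕ → ℤ) → ℤ
  ∑ zero    f = f 0
  ∑ (suc n) f = ∑ n f + f (suc n)

  ∑-cong : ∀ n {f g : ℕ → ℤ} → (∀ k → k ≤ n → f k ≡ g k) → ∑ n f ≡ ∑ n g
  ∑-cong zero    f≗g = f≗g 0 z≤n
  ∑-cong (suc n) f≗g =
    cong₂ _+_ (∑-cong n (λ k k≤n → f≗g k (ℕₚ.m≤n⇒m≤1+n k≤n))) (f≗g (suc n) ℕₚ.≤-refl)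

  ∑-zero : ∀ n {f : ℕ → ℤ} → (∀ k → k ≤ n → f k ≡ + 0) → ∑ n f ≡ + 0
  ∑-zero zero    f≗0 = f≗0 0 z≤n
  ∑-zero (suc n) f≗0 =
    cong₂ _+_ (∑-zero n (λ k k≤n → f≗0 k (ℕₚ.m≤n⇒m≤1+n k≤n))) (f≗0 (suc n) ℕₚ.≤-refl)

  ∑-+ : ∀ n (f g : ℕ → ℤ) → ∑ n (λ k → f k + g k) ≡ ∑ n f + ∑ n g
  ∑-+ zero    f g = refl
  ∑-+ (suc n) f g = trans (cong (_+ (f (suc n) + g (suc n))) (∑-+ n f g))
                          (interchange (∑ n f) (∑ n g) (f (suc n)) (g (suc n)))
    where interchange : ∀ a b c d → a + b + (c + d) ≡ a + c + (b + d)
          interchange = solve-∀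

  ∑-*ˡ : ∀ n c (f : ℕ → ℤ) → ∑ n (λ k → c * f k) ≡ c * ∑ n f
  ∑-*ˡ zero    c f = refl
  ∑-*ˡ (suc n) c f = trans (cong (_+ c * f (suc n)) (∑-*ˡ n c f))
                           (sym (ℤₚ.*-distribˡ-+ c (∑ n f) (f (suc n))))

  ∑-*ʳ : ∀ n c (f : ℕ → ℤ) → ∑ n (λ k → f k * c) ≡ ∑ n f * c
  ∑-*ʳ n c f = begin
    ∑ n (λ k → f k * c) ≡⟨ ∑-cong n (λ k _ → ℤₚ.*-comm (f k) c) ⟩
    ∑ n (λ k → c * f k) ≡⟨ ∑-*ˡ n c f ⟩
    c * ∑ n f           ≡⟨ ℤₚ.*-comm c (∑ n f) ⟩
    ∑ n f * c           ∎

  ∑-neg : ∀ n (f : ℕ → ℤ) → ∑ n (λ k → - f k) ≡ - ∑ n f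
  ∑-neg zero    f = refl
  ∑-neg (suc n) f = trans (cong (_+ - f (suc n)) (∑-neg n f))
                          (sym (ℤₚ.neg-distrib-+ (∑ n f) (f (suc n))))

  ∑-suc : ∀ n (f : ℕ → ℤ) → ∑ (suc n) f ≡ f 0 + ∑ n (λ k → f (suc k))
  ∑-suc zero    f = refl
  ∑-suc (suc n) f = trans (cong (_+ f (suc (suc n))) (∑-suc n f))
                          (ℤₚ.+-assoc (f 0) (∑ n (λ k → f (suc k))) (f (suc (suc n))))

  ∑-comm : ∀ n m (f : ℕ → ℕ → ℤ) →
           ∑ n (λ k → ∑ m (f k)) ≡ ∑ m (λ i → ∑ n (λ k → f k i))
  ∑-comm zero    m f = refl
  ∑-comm (suc n) m f = trans (cong (_+ ∑ m (f (suc n))) (∑-comm n m f))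
                             (sym (∑-+ m (λ i → ∑ n (λ k → f k i)) (f (suc n))))

  ∑-extend : ∀ k d (f : ℕ → ℤ) → (∀ i → k < i → f i ≡ + 0) → ∑ (k ℕ.+ d) f ≡ ∑ k f
  ∑-extend k zero    f tail≗0 = cong (λ x → ∑ x f) (ℕₚ.+-identityʳ k)
  ∑-extend k (suc d) f tail≗0 = begin
    ∑ (k ℕ.+ suc d) f                 ≡⟨ cong (λ x → ∑ x f) (ℕₚ.+-suc k d) ⟩
    ∑ (k ℕ.+ d) f + f (suc (k ℕ.+ d)) ≡⟨ cong₂ _+_ (∑-extend k d f tail≗0)
                                                  (tail≗0 _ (s≤s (ℕₚ.m≤m+n k d))) ⟩
    ∑ k f + + 0                       ≡⟨ ℤₚ.+-identityʳ _ ⟩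
    ∑ k f                             ∎

  ∑-dropPrefix : ∀ i m (f : ℕ → ℤ) → (∀ k → k < i → f k ≡ + 0) →
                 ∑ (i ℕ.+ m) f ≡ ∑ m (λ t → f (i ℕ.+ t))
  ∑-dropPrefix zero    m f prefix≗0 = refl
  ∑-dropPrefix (suc i) m f prefix≗0 = begin
    ∑ (suc (i ℕ.+ m)) f
      ≡⟨ ∑-suc (i ℕ.+ m) f ⟩
    f 0 + ∑ (i ℕ.+ m) (λ k → f (suc k))
      ≡⟨ cong₂ _+_ (prefix≗0 0 (s≤s z≤n))
           (∑-dropPrefix i m (λ k → f (suc k)) (λ k k<i → prefix≗0 (suc k) (s≤s k<i))) ⟩
    + 0 + ∑ m (λ t → f (suc (i ℕ.+ t)))
      ≡⟨ ℤₚ.+-identityˡ _ ⟩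
    ∑ m (λ t → f (suc i ℕ.+ t)) ∎

  sumP-coefficient : ∀ n (F : ℕ → ℕ → ℤ) j → sumP n F j ≡ ∑ n (λ k → F k j)
  sumP-coefficient zero    F j = refl
  sumP-coefficient (suc n) F j = cong (_+ F (suc n) j) (sumP-coefficient n F j)


  ∑-pascal : ∀ k (g : ℕ → ℤ) →
             ∑ (suc k) (λ i → + (suc k C i) * g i)
               ≡ ∑ k (λ i → + (k C i) * g (suc i)) + ∑ k (λ i → + (k C i) * g i)
  ∑-pascal k g = begin
    ∑ (suc k) (λ i → + (suc k C i) * g i)         ≡⟨ ∑-suc k _ ⟩
    + 1 * g 0 + ∑ k (λ i → + (suc k C suc i) * g (suc i))
      ≡⟨ cong (_+_ (+ 1 * g 0)) (trans (∑-cong k (λ i _ → split i)) (∑-+ k _ _)) ⟩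
    + 1 * g 0 + (X + Y)                           ≡⟨ rotate (+ 1 * g 0) X Y ⟩
    X + (+ 1 * g 0 + Y)                           ≡⟨ cong (_+_ X) (sym (∑-suc k (λ i → + (k C i) * g i))) ⟩
    X + (∑ k (λ i → + (k C i) * g i) + + (k C suc k) * g (suc k))
      ≡⟨ cong (λ c → X + (∑ k (λ i → + (k C i) * g i) + + c * g (suc k)))
              (k>n⇒nCk≡0 (ℕₚ.n<1+n k)) ⟩
    X + (∑ k (λ i → + (k C i) * g i) + + 0 * g (suc k))
      ≡⟨ cong (_+_ X) (ℤₚ.+-identityʳ _) ⟩
    X + ∑ k (λ i → + (k C i) * g i) ∎
    where
      X = ∑ k (λ i → + (k C i) * g (suc i))
      Y = ∑ k (λ i → + (k C suc i) * g (suc i))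
      rotate : ∀ a x y → a + (x + y) ≡ x + (a + y)
      rotate = solve-∀
      split : ∀ i → + (suc k C suc i) * g (suc i) ≡ + (k C i) * g (suc i) + + (k C suc i) * g (suc i)
      split i = trans (cong (λ c → + c * g (suc i)) (pascal k i))
                      (trans (cong (_* g (suc i)) (ℤₚ.pos-+ (k C i) (k C suc i)))
                             (ℤₚ.*-distribʳ-+ (g (suc i)) (+ (k C i)) (+ (k C suc i))))

  Δ : (ℕ → ℤ) → ℕ → ℤ
  Δ f t = f (suc t) - f t

  Δ^ : ℕ → (ℕ → ℤ) → ℤ
  Δ^ m f = ∑ m (λ t → + (m C t) * (sgn (m ∸ t) * f t))

  Δ^-cong : ∀ m {f g : ℕ → ℤ} → (∀ t → t ≤ m → f t ≡ g t) → Δ^ m f ≡ Δ^ m g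
  Δ^-cong m f≗g = ∑-cong m (λ t t≤m → cong (λ z → + (m C t) * (sgn (m ∸ t) * z)) (f≗g t t≤m))

  Δ^-zero : ∀ (f : ℕ → ℤ) → Δ^ 0 f ≡ f 0
  Δ^-zero f = trans (ℤₚ.*-identityˡ _) (ℤₚ.*-identityˡ (f 0))

  Δ^-- : ∀ m (f g : ℕ → ℤ) → Δ^ m (λ t → f t - g t) ≡ Δ^ m f - Δ^ m g
  Δ^-- m f g = begin
    Δ^ m (λ t → f t - g t)
      ≡⟨ ∑-cong m (λ t _ → distrib (+ (m C t)) (sgn (m ∸ t)) (f t) (g t)) ⟩
    ∑ m (λ t → + (m C t) * (sgn (m ∸ t) * f t) + - (+ (m C t) * (sgn (m ∸ t) * g t)))
      ≡⟨ ∑-+ m _ _ ⟩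
    Δ^ m f + ∑ m (λ t → - (+ (m C t) * (sgn (m ∸ t) * g t)))
      ≡⟨ cong (_+_ (Δ^ m f)) (∑-neg m _) ⟩
    Δ^ m f - Δ^ m g ∎
    where distrib : ∀ c s x y → c * (s * (x - y)) ≡ c * (s * x) + - (c * (s * y))
          distrib = solve-∀

  Δ^-suc : ∀ m (f : ℕ → ℤ) → Δ^ (suc m) f ≡ Δ^ m (Δ f)
  Δ^-suc m f = begin
    Δ^ (suc m) f                                      ≡⟨ ∑-pascal m (λ t → sgn (suc m ∸ t) * f t) ⟩
    Δ^ m (λ t → f (suc t)) + ∑ m (λ t → + (m C t) * (sgn (suc m ∸ t) * f t))
                                                      ≡⟨ cong (_+_ (Δ^ m (λ t → f (suc t)))) flip ⟩
    Δ^ m (λ t → f (suc t)) - Δ^ m f                   ≡⟨ sym (Δ^-- m (λ t → f (suc t)) f) ⟩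
    Δ^ m (Δ f) ∎
    where
      flipped : ∀ t → t ≤ m → + (m C t) * (sgn (suc m ∸ t) * f t) ≡ - (+ (m C t) * (sgn (m ∸ t) * f t))
      flipped t t≤m = begin
        + (m C t) * (sgn (suc m ∸ t) * f t)
          ≡⟨ cong (λ e → + (m C t) * (sgn e * f t)) (ℕₚ.+-∸-assoc 1 t≤m) ⟩
        + (m C t) * (sgn (suc (m ∸ t)) * f t) ≡⟨ negate (+ (m C t)) (sgn (m ∸ t)) (f t) ⟩
        - (+ (m C t) * (sgn (m ∸ t) * f t)) ∎
        where negate : ∀ c s x → c * (- + 1 * s * x) ≡ - (c * (s * x))
              negate = solve-∀
      flip : ∑ m (λ t → + (m C t) * (sgn (suc m ∸ t) * f t)) ≡ - Δ^ m f
      flip = trans (∑-cong m flipped) (∑-neg m _)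

  module DifferenceTable (b : ℕ → ℕ) (D : ℕ → ℕ → ℕ)
                         (D-zero : ∀ i → D i 0 ≡ b i)
                         (D-suc : ∀ i m → D (suc i) m ≡ D i m ℕ.+ D i (suc m)) where

    D-suc-ℤ : ∀ i m → + D (suc i) m ≡ + D i m + + D i (suc m)
    D-suc-ℤ i m = trans (cong +_ (D-suc i m)) (ℤₚ.pos-+ (D i m) (D i (suc m)))

    Δ^-row : ∀ m i → Δ^ m (λ t → + b (i ℕ.+ t)) ≡ + D i m
    Δ^-row zero    i =
      trans (Δ^-zero (λ t → + b (i ℕ.+ t))) (cong +_ (trans (cong b (ℕₚ.+-identityʳ i)) (sym (D-zero i))))
    Δ^-row (suc m) i = begin
      Δ^ (suc m) (λ t → + b (i ℕ.+ t))
        ≡⟨ Δ^-suc m _ ⟩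
      Δ^ m (λ t → + b (i ℕ.+ suc t) - + b (i ℕ.+ t))
        ≡⟨ Δ^-cong m (λ t _ → cong (λ z → + b z - + b (i ℕ.+ t)) (ℕₚ.+-suc i t)) ⟩
      Δ^ m (λ t → + b (suc i ℕ.+ t) - + b (i ℕ.+ t))
        ≡⟨ Δ^-- m _ _ ⟩
      Δ^ m (λ t → + b (suc i ℕ.+ t)) - Δ^ m (λ t → + b (i ℕ.+ t))
        ≡⟨ cong₂ _-_ (Δ^-row m (suc i)) (Δ^-row m i) ⟩
      + D (suc i) m - + D i m
        ≡⟨ cong (_- + D i m) (D-suc-ℤ i m) ⟩
      + D i m + + D i (suc m) - + D i m
        ≡⟨ cancel (+ D i m) (+ D i (suc m)) ⟩
      + D i (suc m) ∎
      where cancel : ∀ a c → a + c - a ≡ c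
            cancel = solve-∀

    Δ^-antidiagonal : ∀ m r i → Δ^ m (λ t → + D (i ℕ.+ t) (r ℕ.+ (m ∸ t))) ≡ + D i r
    Δ^-antidiagonal zero    r i =
      trans (Δ^-zero (λ t → + D (i ℕ.+ t) (r ℕ.+ (0 ∸ t))))
            (cong₂ (λ x y → + D x y) (ℕₚ.+-identityʳ i) (ℕₚ.+-identityʳ r))
    Δ^-antidiagonal (suc m) r i = begin
      Δ^ (suc m) F
        ≡⟨ Δ^-suc m F ⟩
      Δ^ m (Δ F)
        ≡⟨ Δ^-cong m (λ t t≤m → cong₂ _-_ (upper t) (lower t t≤m)) ⟩
      Δ^ m (λ t → + D (suc i ℕ.+ t) (r ℕ.+ (m ∸ t)) - + D (i ℕ.+ t) (suc r ℕ.+ (m ∸ t)))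
        ≡⟨ Δ^-- m _ _ ⟩
      Δ^ m (λ t → + D (suc i ℕ.+ t) (r ℕ.+ (m ∸ t)))
        - Δ^ m (λ t → + D (i ℕ.+ t) (suc r ℕ.+ (m ∸ t)))
        ≡⟨ cong₂ _-_ (Δ^-antidiagonal m r (suc i)) (Δ^-antidiagonal m (suc r) i) ⟩
      + D (suc i) r - + D i (suc r)
        ≡⟨ cong (_- + D i (suc r)) (D-suc-ℤ i r) ⟩
      + D i r + + D i (suc r) - + D i (suc r)
        ≡⟨ cancel (+ D i r) (+ D i (suc r)) ⟩
      + D i r ∎
      where
        F = λ t → + D (i ℕ.+ t) (r ℕ.+ (suc m ∸ t))
        upper : ∀ t → F (suc t) ≡ + D (suc i ℕ.+ t) (r ℕ.+ (m ∸ t))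
        upper t = cong (λ z → + D z (r ℕ.+ (m ∸ t))) (ℕₚ.+-suc i t)
        lower : ∀ t → t ≤ m → F t ≡ + D (i ℕ.+ t) (suc r ℕ.+ (m ∸ t))
        lower t t≤m = cong (λ z → + D (i ℕ.+ t) z)
                           (trans (cong (r ℕ.+_) (ℕₚ.+-∸-assoc 1 t≤m)) (ℕₚ.+-suc r (m ∸ t)))
        cancel : ∀ a c → a + c - c ≡ a
        cancel = solve-∀

  S-suc-suc : ∀ k j → + S (suc k) (suc j) ≡ ∑ k (λ i → + (k C i) * + S i j)
  S-suc-suc zero    j =
    trans (cong (λ z → + (z ℕ.+ S 0 j)) (ℕₚ.*-zeroʳ (suc j))) (sym (ℤₚ.*-identityˡ (+ S 0 j)))
  S-suc-suc (suc k) zero = begin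
    + (1 ℕ.* S (suc k) 1 ℕ.+ 0)
      ≡⟨ cong +_ (trans (ℕₚ.+-identityʳ _) (ℕₚ.*-identityˡ _)) ⟩
    + S (suc k) 1
      ≡⟨ S-suc-suc k 0 ⟩
    ∑ k (λ i → + (k C i) * + S i 0)
      ≡⟨ sym (ℤₚ.+-identityˡ _) ⟩
    + 0 + ∑ k (λ i → + (k C i) * + S i 0)
      ≡⟨ cong (_+ ∑ k (λ i → + (k C i) * + S i 0))
              (sym (∑-zero k (λ i _ → ℤₚ.*-zeroʳ (+ (k C i))))) ⟩
    ∑ k (λ i → + (k C i) * + S (suc i) 0) + ∑ k (λ i → + (k C i) * + S i 0)
      ≡⟨ sym (∑-pascal k (λ i → + S i 0)) ⟩
    ∑ (suc k) (λ i → + (suc k C i) * + S i 0) ∎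
  S-suc-suc (suc k) (suc j) = begin
    + (suc (suc j) ℕ.* S (suc k) (suc (suc j)) ℕ.+ S (suc k) (suc j))
        ≡⟨ cast (suc j) (S (suc k) (suc (suc j))) (S (suc k) (suc j)) ⟩
    + suc j * + S (suc k) (suc (suc j)) + + S (suc k) (suc j) + + S (suc k) (suc (suc j))
        ≡⟨ cong₂ (λ p q → + suc j * p + q + p) (S-suc-suc k (suc j)) (S-suc-suc k j) ⟩
    + suc j * R (suc j) + R j + R (suc j)
        ≡⟨ cong (_+ R (suc j)) (sym unfolded) ⟩
    ∑ k (λ i → + (k C i) * + S (suc i) (suc j)) + R (suc j)
        ≡⟨ sym (∑-pascal k (λ i → + S i (suc j))) ⟩
    ∑ (suc k) (λ i → + (suc k C i) * + S i (suc j)) ∎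
    where
      R = λ j → ∑ k (λ i → + (k C i) * + S i j)
      cast : ∀ s a c → + (suc s ℕ.* a ℕ.+ c) ≡ + s * + a + + c + + a
      cast s a c = trans (ℤₚ.pos-+ (suc s ℕ.* a) c)
                         (trans (cong (_+ + c) (ℤₚ.pos-* (suc s) a))
                                (trans (cong (λ z → z * + a + + c) (ℤₚ.pos-+ 1 s))
                                       (shuffle (+ s) (+ a) (+ c))))
        where shuffle : ∀ s a c → (+ 1 + s) * a + c ≡ s * a + c + a
              shuffle = solve-∀
      recurrence : ∀ i → + (k C i) * + S (suc i) (suc j)
                           ≡ + suc j * (+ (k C i) * + S i (suc j)) + + (k C i) * + S i j
      recurrence i = begin
        + (k C i) * + (suc j ℕ.* S i (suc j) ℕ.+ S i j)
          ≡⟨ cong (+ (k C i) *_) (trans (ℤₚ.pos-+ _ (S i j))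
                                        (cong (_+ + S i j) (ℤₚ.pos-* (suc j) (S i (suc j))))) ⟩
        + (k C i) * (+ suc j * + S i (suc j) + + S i j)
          ≡⟨ expand (+ (k C i)) (+ suc j) (+ S i (suc j)) (+ S i j) ⟩
        + suc j * (+ (k C i) * + S i (suc j)) + + (k C i) * + S i j ∎
        where expand : ∀ c s a b → c * (s * a + b) ≡ s * (c * a) + c * b
              expand = solve-∀
      unfolded : ∑ k (λ i → + (k C i) * + S (suc i) (suc j)) ≡ + suc j * R (suc j) + R j
      unfolded = trans (∑-cong k (λ i _ → recurrence i))
                       (trans (∑-+ k _ _) (cong (_+ R j) (∑-*ˡ k (+ suc j) _)))

  S-suc-suc-≤ : ∀ k n j → k ≤ n → + S (suc k) (suc j) ≡ ∑ n (λ i → + (k C i) * + S i j)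
  S-suc-suc-≤ k n j k≤n = begin
    + S (suc k) (suc j)
      ≡⟨ S-suc-suc k j ⟩
    ∑ k f
      ≡⟨ sym (∑-extend k (n ∸ k) f (λ i k<i → cong (λ c → + c * + S i j) (k>n⇒nCk≡0 k<i))) ⟩
    ∑ (k ℕ.+ (n ∸ k)) f
      ≡⟨ cong (λ z → ∑ z f) (ℕₚ.m+[n∸m]≡n k≤n) ⟩
    ∑ n f ∎
    where f = λ i → + (k C i) * + S i j

  BellPoly-transform : ∀ n (a b : ℕ → ℤ) →
                       (∀ i → i ≤ n → ∑ n (λ k → a k * + (k C i)) ≡ b i) →
                       sumP n (λ k → scale (a k) (BellPoly (suc k)))
                         ≈P yTimes (sumP n (λ k → scale (b k) (BellPoly k)))
  BellPoly-transform n a b a↦b zero =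
    trans (sumP-coefficient n _ 0) (∑-zero n (λ k _ → ℤₚ.*-zeroʳ (a k)))
  BellPoly-transform n a b a↦b (suc j) = begin
    sumP n (λ k → scale (a k) (BellPoly (suc k))) (suc j)
      ≡⟨ sumP-coefficient n _ (suc j) ⟩
    ∑ n (λ k → a k * + S (suc k) (suc j))
      ≡⟨ ∑-cong n (λ k k≤n → cong (a k *_) (S-suc-suc-≤ k n j k≤n)) ⟩
    ∑ n (λ k → a k * ∑ n (λ i → + (k C i) * + S i j))
      ≡⟨ ∑-cong n (λ k _ → sym (∑-*ˡ n (a k) _)) ⟩
    ∑ n (λ k → ∑ n (λ i → a k * (+ (k C i) * + S i j)))
      ≡⟨ ∑-comm n n _ ⟩
    ∑ n (λ i → ∑ n (λ k → a k * (+ (k C i) * + S i j)))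
      ≡⟨ ∑-cong n (λ i _ → trans (∑-cong n (λ k _ → sym (ℤₚ.*-assoc (a k) _ _)))
                                  (∑-*ʳ n _ _)) ⟩
    ∑ n (λ i → ∑ n (λ k → a k * + (k C i)) * + S i j)
      ≡⟨ ∑-cong n (λ i i≤n → cong (_* + S i j) (a↦b i i≤n)) ⟩
    ∑ n (λ i → b i * + S i j)
      ≡⟨ sym (sumP-coefficient n _ j) ⟩
    yTimes (sumP n (λ k → scale (b k) (BellPoly k))) (suc j) ∎

  ∑-sgn-C-C≡C*Δ^ : ∀ i m (x : ℕ → ℕ) →
    ∑ (i ℕ.+ m) (λ k → sgn ((i ℕ.+ m) ∸ k) * + (((i ℕ.+ m) C k) ℕ.* x k) * + (k C i))
      ≡ + ((i ℕ.+ m) C i) * Δ^ m (λ t → + x (i ℕ.+ t))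
  ∑-sgn-C-C≡C*Δ^ i m x = begin
    ∑ (i ℕ.+ m) f                                      ≡⟨ ∑-dropPrefix i m f vanish ⟩
    ∑ m (λ t → f (i ℕ.+ t))                            ≡⟨ ∑-cong m (λ t _ → revise t) ⟩
    ∑ m (λ t → + ((i ℕ.+ m) C i) * (+ (m C t) * (sgn (m ∸ t) * + x (i ℕ.+ t))))
                                                       ≡⟨ ∑-*ˡ m (+ ((i ℕ.+ m) C i)) _ ⟩
    + ((i ℕ.+ m) C i) * Δ^ m (λ t → + x (i ℕ.+ t)) ∎
    where
      a = λ k → sgn ((i ℕ.+ m) ∸ k) * + (((i ℕ.+ m) C k) ℕ.* x k)
      f = λ k → a k * + (k C i)
      vanish : ∀ k → k < i → f k ≡ + 0
      vanish k k<i = trans (cong (λ c → a k * + c) (k>n⇒nCk≡0 k<i)) (ℤₚ.*-zeroʳ (a k))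
      revise : ∀ t → f (i ℕ.+ t) ≡ + ((i ℕ.+ m) C i) * (+ (m C t) * (sgn (m ∸ t) * + x (i ℕ.+ t)))
      revise t = begin
        sgn ((i ℕ.+ m) ∸ (i ℕ.+ t)) * + (P ℕ.* X) * + Q
          ≡⟨ cong (λ e → sgn e * + (P ℕ.* X) * + Q) (ℕₚ.[m+n]∸[m+o]≡n∸o i m t) ⟩
        sgn (m ∸ t) * + (P ℕ.* X) * + Q
          ≡⟨ cong (λ z → sgn (m ∸ t) * z * + Q) (ℤₚ.pos-* P X) ⟩
        sgn (m ∸ t) * (+ P * + X) * + Q
          ≡⟨ regroup (sgn (m ∸ t)) (+ P) (+ X) (+ Q) ⟩
        sgn (m ∸ t) * + X * (+ P * + Q)
          ≡⟨ cong (sgn (m ∸ t) * + X *_) (sym (ℤₚ.pos-* P Q)) ⟩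
        sgn (m ∸ t) * + X * + (P ℕ.* Q)
          ≡⟨ cong (λ z → sgn (m ∸ t) * + X * + z) (trinomial-revision i m t) ⟩
        sgn (m ∸ t) * + X * + (((i ℕ.+ m) C i) ℕ.* (m C t))
          ≡⟨ cong (sgn (m ∸ t) * + X *_) (ℤₚ.pos-* ((i ℕ.+ m) C i) (m C t)) ⟩
        sgn (m ∸ t) * + X * (+ ((i ℕ.+ m) C i) * + (m C t))
          ≡⟨ regroup′ (sgn (m ∸ t)) (+ X) (+ ((i ℕ.+ m) C i)) (+ (m C t)) ⟩
        + ((i ℕ.+ m) C i) * (+ (m C t) * (sgn (m ∸ t) * + X)) ∎
        where
          P = (i ℕ.+ m) C (i ℕ.+ t)
          Q = (i ℕ.+ t) C i
          X = x (i ℕ.+ t)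
          regroup : ∀ s p x q → s * (p * x) * q ≡ s * x * (p * q)
          regroup = solve-∀
          regroup′ : ∀ s x c d → s * x * (c * d) ≡ c * (d * (s * x))
          regroup′ = solve-∀

module RestrictedGrowth where

  open import Defs
  open import Data.Nat using (ℕ; zero; suc; _+_; _*_; _∸_; _≤_; _<_; z≤n; s≤s; _≡ᵇ_; _<ᵇ_)
  open import Data.Nat.Properties
  open import Data.Nat.Tactic.RingSolver using (solve-∀)
  open import Data.Bool using (Bool; true; false; if_then_else_; _∧_; not)
  open import Data.Bool.Properties using (∧-zeroʳ; T-≡)
  open import Function using (_∘_; Equivalence)
  open import Data.List using (List; []; _∷_; map; concatMap; upTo; length; _++_; _∷ʳ_; [_])
  open import Data.List.Properties using (upTo-∷ʳ; ++-assoc; ++-identityʳ; length-++)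
  open import Data.Product using (_×_; _,_; ∃)
  open import Data.Sum using (inj₁; inj₂)
  open import Data.Unit using (⊤; tt)
  open import Data.Empty using (⊥; ⊥-elim)
  open import Relation.Binary.Definitions using (tri<; tri≈; tri>)
  open import Relation.Binary.PropositionalEquality hiding ([_])
  open ≡-Reasoning

  toℕ : Bool → ℕ
  toℕ true  = 1
  toℕ false = 0

  countB-∷ : ∀ {A : Set} (p : A → Bool) x xs → countB p (x ∷ xs) ≡ toℕ (p x) + countB p xs
  countB-∷ p x xs with p x
  ... | true  = refl
  ... | false = refl

  countB-++ : ∀ {A : Set} (p : A → Bool) xs ys → countB p (xs ++ ys) ≡ countB p xs + countB p ys
  countB-++ p []       ys = refl
  countB-++ p (x ∷ xs) ys = begin
    countB p (x ∷ xs ++ ys)                  ≡⟨ countB-∷ p x (xs ++ ys) ⟩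
    toℕ (p x) + countB p (xs ++ ys)          ≡⟨ cong (toℕ (p x) +_) (countB-++ p xs ys) ⟩
    toℕ (p x) + (countB p xs + countB p ys)  ≡⟨ sym (+-assoc (toℕ (p x)) _ _) ⟩
    toℕ (p x) + countB p xs + countB p ys    ≡⟨ cong (_+ countB p ys) (sym (countB-∷ p x xs)) ⟩
    countB p (x ∷ xs) + countB p ys          ∎

  countB-map : ∀ {A B : Set} (p : B → Bool) (f : A → B) xs →
               countB p (map f xs) ≡ countB (λ x → p (f x)) xs
  countB-map p f []       = refl
  countB-map p f (x ∷ xs) with p (f x)
  ... | true  = cong suc (countB-map p f xs)
  ... | false = countB-map p f xs

  countB-cong : ∀ {A : Set} {p q : A → Bool} xs → (∀ x → p x ≡ q x) → countB p xs ≡ countB q xs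
  countB-cong {p = p} {q} []       p≗q = refl
  countB-cong {p = p} {q} (x ∷ xs) p≗q =
    trans (countB-∷ p x xs)
          (trans (cong₂ _+_ (cong toℕ (p≗q x)) (countB-cong xs p≗q)) (sym (countB-∷ q x xs)))

  countB-none : ∀ {A : Set} (p : A → Bool) xs → (∀ x → p x ≡ false) → countB p xs ≡ 0
  countB-none p []       p≗false = refl
  countB-none p (x ∷ xs) p≗false rewrite p≗false x = countB-none p xs p≗false

  countB-all : ∀ {A : Set} (xs : List A) → countB (λ _ → true) xs ≡ length xs
  countB-all []       = refl
  countB-all (x ∷ xs) = cong suc (countB-all xs)

  ≡ᵇ-refl : ∀ n → (n ≡ᵇ n) ≡ true
  ≡ᵇ-refl n = Equivalence.to T-≡ (≡⇒≡ᵇ n n refl)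

  ≡ᵇ-sound : ∀ m n → (m ≡ᵇ n) ≡ true → m ≡ n
  ≡ᵇ-sound m n = ≡ᵇ⇒≡ m n ∘ Equivalence.from T-≡

  ≢⇒≡ᵇ-false : ∀ m n → m ≢ n → (m ≡ᵇ n) ≡ false
  ≢⇒≡ᵇ-false m n m≢n with m ≡ᵇ n in m≡ᵇn
  ... | false = refl
  ... | true  = ⊥-elim (m≢n (≡ᵇ-sound m n m≡ᵇn))

  <ᵇ-true : ∀ {m n} → m < n → (m <ᵇ n) ≡ true
  <ᵇ-true = Equivalence.to T-≡ ∘ <⇒<ᵇ

  <ᵇ-false : ∀ {m n} → n ≤ m → (m <ᵇ n) ≡ false
  <ᵇ-false {m}     {zero}  _         = refl
  <ᵇ-false {suc m} {suc n} (s≤s n≤m) = <ᵇ-false n≤m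

  <ᵇ-sound : ∀ m n → (m <ᵇ n) ≡ true → m < n
  <ᵇ-sound m n = <ᵇ⇒< m n ∘ Equivalence.from T-≡

  ≥2⇒≡ᵇ1-false : ∀ {n} → 2 ≤ n → (n ≡ᵇ 1) ≡ false
  ≥2⇒≡ᵇ1-false (s≤s (s≤s _)) = refl

  ∧-true : ∀ a b → a ∧ b ≡ true → (a ≡ true) × (b ≡ true)
  ∧-true true true _ = refl , refl

  ∑< : ℕ → (ℕ → ℕ) → ℕ
  ∑< zero    g = 0
  ∑< (suc n) g = ∑< n g + g n

  ∑<-cong : ∀ n {g h : ℕ → ℕ} → (∀ l → l < n → g l ≡ h l) → ∑< n g ≡ ∑< n h
  ∑<-cong zero    g≗h = refl
  ∑<-cong (suc n) g≗h = cong₂ _+_ (∑<-cong n (λ l l<n → g≗h l (m≤n⇒m≤1+n l<n))) (g≗h n ≤-refl)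

  ∑<-+ : ∀ n (g h : ℕ → ℕ) → ∑< n (λ l → g l + h l) ≡ ∑< n g + ∑< n h
  ∑<-+ zero    g h = refl
  ∑<-+ (suc n) g h = trans (cong (_+ (g n + h n)) (∑<-+ n g h)) (interchange (∑< n g) (∑< n h) (g n) (h n))
    where interchange : ∀ a b c d → a + b + (c + d) ≡ a + c + (b + d)
          interchange = solve-∀

  ∑<-*ʳ : ∀ n (g : ℕ → ℕ) c → ∑< n (λ l → g l * c) ≡ ∑< n g * c
  ∑<-*ʳ zero    g c = refl
  ∑<-*ʳ (suc n) g c = trans (cong (_+ g n * c) (∑<-*ʳ n g c)) (sym (*-distribʳ-+ c (∑< n g) (g n)))

  ∑<-const : ∀ n {g : ℕ → ℕ} c → (∀ l → l < n → g l ≡ c) → ∑< n g ≡ n * c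
  ∑<-const zero    c g≗c = refl
  ∑<-const (suc n) c g≗c =
    trans (cong₂ _+_ (∑<-const n c (λ l l<n → g≗c l (m≤n⇒m≤1+n l<n))) (g≗c n ≤-refl))
          (+-comm (n * c) c)

  ∑<-extend : ∀ c d (g : ℕ → ℕ) → (∀ l → c ≤ l → g l ≡ 0) → ∑< (c + d) g ≡ ∑< c g
  ∑<-extend c zero    g tail≗0 = cong (λ n → ∑< n g) (+-identityʳ c)
  ∑<-extend c (suc d) g tail≗0 = begin
    ∑< (c + suc d) g              ≡⟨ cong (λ n → ∑< n g) (+-suc c d) ⟩
    ∑< (c + d) g + g (c + d)      ≡⟨ cong₂ _+_ (∑<-extend c d g tail≗0)
                                               (tail≗0 (c + d) (m≤m+n c d)) ⟩
    ∑< c g + 0                    ≡⟨ +-identityʳ _ ⟩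
    ∑< c g                        ∎

  ∑<-update : ∀ n l (g h : ℕ → ℕ) → l < n → (∀ x → x < n → x ≢ l → g x ≡ h x) →
              ∑< n g + h l ≡ ∑< n h + g l
  ∑<-update (suc n) l g h l<1+n g≗h with m≤n⇒m<n∨m≡n (≤-pred l<1+n)
  ... | inj₁ l<n = begin
    ∑< n g + g n + h l    ≡⟨ swap (∑< n g) (g n) (h l) ⟩
    ∑< n g + h l + g n    ≡⟨ cong₂ _+_ (∑<-update n l g h l<n (λ x x<n → g≗h x (m≤n⇒m≤1+n x<n)))
                                       (g≗h n ≤-refl (λ n≡l → <⇒≢ l<n (sym n≡l))) ⟩
    ∑< n h + g l + h n    ≡⟨ swap (∑< n h) (g l) (h n) ⟩
    ∑< n h + h n + g l    ∎
    where swap : ∀ a b c → a + b + c ≡ a + c + b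
          swap = solve-∀
  ... | inj₂ refl = begin
    ∑< l g + g l + h l
      ≡⟨ cong (λ z → z + g l + h l)
              (∑<-cong l (λ x x<l → g≗h x (m≤n⇒m≤1+n x<l) (<⇒≢ x<l))) ⟩
    ∑< l h + g l + h l
      ≡⟨ swap (∑< l h) (g l) (h l) ⟩
    ∑< l h + h l + g l ∎
    where swap : ∀ a b c → a + b + c ≡ a + c + b
          swap = solve-∀

  ∑<≡0 : ∀ n (g : ℕ → ℕ) → ∑< n g ≡ 0 → ∀ l → l < n → g l ≡ 0
  ∑<≡0 (suc n) g sum≡0 l l<1+n with m≤n⇒m<n∨m≡n (≤-pred l<1+n)
  ... | inj₁ l<n  = ∑<≡0 n g (m+n≡0⇒m≡0 (∑< n g) sum≡0) l l<n
  ... | inj₂ refl = m+n≡0⇒n≡0 (∑< l g) sum≡0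

  count< : ℕ → (ℕ → Bool) → ℕ
  count< n p = ∑< n (λ l → toℕ (p l))

  countB-upTo : ∀ n (p : ℕ → Bool) → countB p (upTo n) ≡ count< n p
  countB-upTo zero    p = refl
  countB-upTo (suc n) p = begin
    countB p (upTo (suc n))
      ≡⟨ cong (countB p) (sym (upTo-∷ʳ n)) ⟩
    countB p (upTo n ++ [ n ])
      ≡⟨ countB-++ p (upTo n) [ n ] ⟩
    countB p (upTo n) + countB p [ n ]
      ≡⟨ cong₂ _+_ (countB-upTo n p) (trans (countB-∷ p n []) (+-identityʳ _)) ⟩
    count< n p + toℕ (p n) ∎

  countB-concatMap-upTo : ∀ {B : Set} (p : B → Bool) (F : ℕ → List B) n →
                          countB p (concatMap F (upTo n)) ≡ ∑< n (λ l → countB p (F l))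
  countB-concatMap-upTo p F zero    = refl
  countB-concatMap-upTo p F (suc n) = begin
    countB p (concatMap F (upTo (suc n)))
      ≡⟨ cong (λ ls → countB p (concatMap F ls)) (sym (upTo-∷ʳ n)) ⟩
    countB p (concatMap F (upTo n ∷ʳ n))
      ≡⟨ cong (countB p) (concatMap-∷ʳ (upTo n)) ⟩
    countB p (concatMap F (upTo n) ++ F n)
      ≡⟨ countB-++ p (concatMap F (upTo n)) (F n) ⟩
    countB p (concatMap F (upTo n)) + countB p (F n)
      ≡⟨ cong (_+ countB p (F n)) (countB-concatMap-upTo p F n) ⟩
    ∑< n (λ l → countB p (F l)) + countB p (F n) ∎
    where
      concatMap-∷ʳ : ∀ xs {x} → concatMap F (xs ∷ʳ x) ≡ concatMap F xs ++ F x
      concatMap-∷ʳ []       = ++-identityʳ _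
      concatMap-∷ʳ (y ∷ xs) = trans (cong (F y ++_) (concatMap-∷ʳ xs)) (sym (++-assoc (F y) _ _))

  count<-none : ∀ n (p : ℕ → Bool) → (∀ x → x < n → p x ≡ false) → count< n p ≡ 0
  count<-none n p p≗false = trans (∑<-const n 0 (λ x x<n → cong toℕ (p≗false x x<n))) (*-zeroʳ n)

  count<≡0⇒false : ∀ n p → count< n p ≡ 0 → ∀ x → x < n → p x ≡ false
  count<≡0⇒false n p count≡0 x x<n with p x | ∑<≡0 n (λ l → toℕ (p l)) count≡0 x x<n
  ... | false | _ = refl

  count<≡0-transfer : ∀ n p q → (∀ x → x < n → q x ≡ true → ∃ λ y → y < n × p y ≡ true) →
                      count< n p ≡ 0 → count< n q ≡ 0
  count<≡0-transfer n p q q⇒p p≡0 = count<-none n q q-false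
    where
      q-false : ∀ x → x < n → q x ≡ false
      q-false x x<n with q x in qx
      ... | false = refl
      ... | true with q⇒p x x<n qx
      ...   | y , y<n , py with trans (sym py) (count<≡0⇒false n p p≡0 y y<n)
      ...     | ()

  ≡ᵇ0-cong : ∀ {a b} → (a ≡ 0 → b ≡ 0) → (b ≡ 0 → a ≡ 0) → (a ≡ᵇ 0) ≡ (b ≡ᵇ 0)
  ≡ᵇ0-cong {zero}  {zero}  _   _   = refl
  ≡ᵇ0-cong {zero}  {suc b} a⇒b _   = ⊥-elim (1+n≢0 (a⇒b refl))
  ≡ᵇ0-cong {suc a} {zero}  _   b⇒a = ⊥-elim (1+n≢0 (b⇒a refl))
  ≡ᵇ0-cong {suc a} {suc b} _   _   = refl

  count<-≡ᵇ : ∀ n {K} → K < n → count< n (λ l → l ≡ᵇ K) ≡ 1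
  count<-≡ᵇ (suc n) {K} K<1+n with m≤n⇒m<n∨m≡n (≤-pred K<1+n)
  ... | inj₁ K<n  rewrite count<-≡ᵇ n K<n | ≢⇒≡ᵇ-false n K (λ n≡K → <⇒≢ K<n (sym n≡K)) = refl
  ... | inj₂ refl rewrite ≡ᵇ-refl K = cong (_+ 1) earlier
    where earlier : count< K (λ l → l ≡ᵇ K) ≡ 0
          earlier = count<-none K _ (λ l l<K → ≢⇒≡ᵇ-false l K (<⇒≢ l<K))

  classify : ∀ e p (α β : ℕ) →
             (if e then 0 else if p then α else β) ≡ toℕ (not e ∧ p) * α + toℕ (not e ∧ not p) * β
  classify true  p     α β = refl
  classify false true  α β = sym (trans (+-identityʳ (1 * α)) (*-identityˡ α))
  classify false false α β = sym (*-identityˡ β)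

  trichotomy : ∀ e p → toℕ e + toℕ (not e ∧ p) + toℕ (not e ∧ not p) ≡ 1
  trichotomy true  p     = refl
  trichotomy false true  = refl
  trichotomy false false = refl

  count<-≢-∧ : ∀ n K (p : ℕ → Bool) → p K ≡ false →
               count< n (λ l → not (l ≡ᵇ K) ∧ p l) ≡ count< n p
  count<-≢-∧ n K p pK≡false = ∑<-cong n (λ l _ → cong toℕ (drop-≢ l))
    where drop-≢ : ∀ l → (not (l ≡ᵇ K) ∧ p l) ≡ p l
          drop-≢ l with l ≡ᵇ K in l≡ᵇK
          ... | false = refl
          ... | true rewrite ≡ᵇ-sound l K l≡ᵇK | pK≡false = refl

  count<-≢-∧-not : ∀ n K (p : ℕ → Bool) → K < n → p K ≡ false →
                   suc (count< n p + count< n (λ l → not (l ≡ᵇ K) ∧ not (p l))) ≡ n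
  count<-≢-∧-not n K p K<n pK≡false = begin
    suc (count< n p + count< n rest)
      ≡⟨ cong₂ (λ a b → a + b + count< n rest)
                (sym (count<-≡ᵇ n K<n)) (sym (count<-≢-∧ n K p pK≡false)) ⟩
    count< n (λ l → l ≡ᵇ K) + count< n (λ l → not (l ≡ᵇ K) ∧ p l) + count< n rest
      ≡⟨ sym (trans (∑<-+ n _ _) (cong (_+ count< n rest) (∑<-+ n _ _))) ⟩
    ∑< n (λ l → toℕ (l ≡ᵇ K) + toℕ (not (l ≡ᵇ K) ∧ p l) + toℕ (rest l))
      ≡⟨ ∑<-const n 1 (λ l _ → trichotomy (l ≡ᵇ K) (p l)) ⟩
    n * 1
      ≡⟨ *-identityʳ n ⟩
    n ∎
    where rest = λ l → not (l ≡ᵇ K) ∧ not (p l)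

  nextBound : ℕ → ℕ → ℕ
  nextBound l b = if l ≡ᵇ b then suc b else b

  nextBound-old : ∀ {l b} → l < b → nextBound l b ≡ b
  nextBound-old {l} {b} l<b rewrite ≢⇒≡ᵇ-false l b (<⇒≢ l<b) = refl

  nextBound-new : ∀ b → nextBound b b ≡ suc b
  nextBound-new b rewrite ≡ᵇ-refl b = refl

  nextBound-≤ : ∀ l b → nextBound l b ≤ suc b
  nextBound-≤ l b with l ≡ᵇ b
  ... | true  = ≤-refl
  ... | false = n≤1+n b

  countB-rgs : ∀ (p : List ℕ → Bool) m b →
               countB p (rgs (suc m) b)
                 ≡ ∑< (suc b) (λ l → countB (λ s → p (l ∷ s)) (rgs m (nextBound l b)))
  countB-rgs p m b = trans (countB-concatMap-upTo p (λ l → map (l ∷_) (rgs m (nextBound l b))) (suc b))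
                           (∑<-cong (suc b) (λ l _ → countB-map p (l ∷_) (rgs m (nextBound l b))))

  IsRGS : ℕ → List ℕ → Set
  IsRGS b []      = ⊤
  IsRGS b (l ∷ s) = l ≤ b × IsRGS (nextBound l b) s

  countB-rgs-cong : ∀ m b {p q : List ℕ → Bool} → (∀ w → IsRGS b w → length w ≡ m → p w ≡ q w) →
                    countB p (rgs m b) ≡ countB q (rgs m b)
  countB-rgs-cong zero    b p≗q rewrite p≗q [] tt refl = refl
  countB-rgs-cong (suc m) b {p} {q} p≗q =
    trans (countB-rgs p m b) (trans (∑<-cong (suc b) branch) (sym (countB-rgs q m b)))
    where
      branch : ∀ l → l < suc b → countB (λ s → p (l ∷ s)) (rgs m (nextBound l b))
                                ≡ countB (λ s → q (l ∷ s)) (rgs m (nextBound l b))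
      branch l (s≤s l≤b) =
        countB-rgs-cong m (nextBound l b) (λ w rgs-w len → p≗q (l ∷ w) (l≤b , rgs-w) (cong suc len))

  -- grow i c h sums h over the final number of blocks of the i-letter extensions of a string with
  -- c blocks. completions m f u counts the m-letter extensions of a string containing the intended
  -- singleton K, u blocks above K that are still singletons and f further blocks, in which K stays a
  -- singleton and no singleton above K remains.
  grow : ℕ → ℕ → (ℕ → ℕ) → ℕ
  grow zero    c h = h c
  grow (suc i) c h = c * grow i c h + grow i (suc c) h

  completions : ℕ → ℕ → ℕ → ℕ
  completions zero    f zero    = 1
  completions zero    f (suc u) = 0
  completions (suc m) f zero    = f * completions m f 0 + completions m f 1
  completions (suc m) f (suc u) =
    f * completions m f (suc u) + suc u * completions m (suc f) u + completions m f (suc (suc u))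

  D : ℕ → ℕ → ℕ
  D i m = grow i 0 (λ c → completions m c 0)

  grow-cong : ∀ i c {h h′ : ℕ → ℕ} → (∀ b → h b ≡ h′ b) → grow i c h ≡ grow i c h′
  grow-cong zero    c h≗h′ = h≗h′ c
  grow-cong (suc i) c h≗h′ =
    cong₂ (λ x y → c * x + y) (grow-cong i c h≗h′) (grow-cong i (suc c) h≗h′)

  grow-+ : ∀ i c (h h′ : ℕ → ℕ) → grow i c (λ b → h b + h′ b) ≡ grow i c h + grow i c h′
  grow-+ zero    c h h′ = refl
  grow-+ (suc i) c h h′ = begin
    c * grow i c (λ b → h b + h′ b) + grow i (suc c) (λ b → h b + h′ b)
      ≡⟨ cong₂ (λ x y → c * x + y) (grow-+ i c h h′) (grow-+ i (suc c) h h′) ⟩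
    c * (grow i c h + grow i c h′) + (grow i (suc c) h + grow i (suc c) h′)
      ≡⟨ distrib c (grow i c h) (grow i c h′) (grow i (suc c) h) (grow i (suc c) h′) ⟩
    (c * grow i c h + grow i (suc c) h) + (c * grow i c h′ + grow i (suc c) h′) ∎
    where distrib : ∀ c a b x y → c * (a + b) + (x + y) ≡ (c * a + x) + (c * b + y)
          distrib = solve-∀

  grow-suc : ∀ i c h → grow (suc i) c h ≡ grow i c (λ b → b * h b + h (suc b))
  grow-suc zero    c h = refl
  grow-suc (suc i) c h = cong₂ (λ x y → c * x + y) (grow-suc i c h) (grow-suc i (suc c) h)

  completions-settle : ∀ m f u → completions m f (suc u) + completions m f u ≡ completions m (suc f) u
  completions-settle zero    f zero    = refl
  completions-settle zero    f (suc u) = refl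
  completions-settle (suc m) f zero    = begin
    (f * G f 1 + 1 * G (suc f) 0 + G f 2) + (f * G f 0 + G f 1)
      ≡⟨ regroup f (G f 1) (G (suc f) 0) (G f 2) (G f 0) ⟩
    f * (G f 1 + G f 0) + G (suc f) 0 + (G f 2 + G f 1)
      ≡⟨ cong₂ (λ x y → f * x + G (suc f) 0 + y)
               (completions-settle m f 0) (completions-settle m f 1) ⟩
    f * G (suc f) 0 + G (suc f) 0 + G (suc f) 1
      ≡⟨ cong (_+ G (suc f) 1) (+-comm (f * G (suc f) 0) _) ⟩
    suc f * G (suc f) 0 + G (suc f) 1 ∎
    where
      G = completions m
      regroup : ∀ f a b c d → (f * a + 1 * b + c) + (f * d + a) ≡ f * (a + d) + b + (c + a)
      regroup = solve-∀
  completions-settle (suc m) f (suc u) = begin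
    (f * G f (2 + u) + (2 + u) * G (suc f) (suc u) + G f (3 + u))
      + (f * G f (suc u) + suc u * G (suc f) u + G f (2 + u))
      ≡⟨ regroup f (suc u) (G f (2 + u)) (G (suc f) (suc u)) (G f (3 + u)) (G f (suc u)) (G (suc f) u) ⟩
    f * (G f (2 + u) + G f (suc u)) + G (suc f) (suc u)
      + suc u * (G (suc f) (suc u) + G (suc f) u) + (G f (3 + u) + G f (2 + u))
      ≡⟨ cong₂ _+_ (cong₂ (λ x y → f * x + G (suc f) (suc u) + suc u * y)
                          (completions-settle m f (suc u)) (completions-settle m (suc f) u))
                   (completions-settle m f (2 + u)) ⟩
    f * G (suc f) (suc u) + G (suc f) (suc u) + suc u * G (2 + f) u + G (suc f) (2 + u)
      ≡⟨ cong (λ z → z + suc u * G (2 + f) u + G (suc f) (2 + u)) (+-comm (f * G (suc f) (suc u)) _) ⟩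
    suc f * G (suc f) (suc u) + suc u * G (2 + f) u + G (suc f) (2 + u) ∎
    where
      G = completions m
      regroup : ∀ f u a b c d e → (f * a + suc u * b + c) + (f * d + u * e + a)
                                 ≡ f * (a + d) + b + u * (b + e) + (c + a)
      regroup = solve-∀

  D-suc : ∀ i m → D (suc i) m ≡ D i m + D i (suc m)
  D-suc i m = begin
    grow (suc i) 0 (λ b → completions m b 0)                          ≡⟨ grow-suc i 0 _ ⟩
    grow i 0 (λ b → b * completions m b 0 + completions m (suc b) 0)  ≡⟨ grow-cong i 0 step ⟩
    grow i 0 (λ b → completions m b 0 + completions (suc m) b 0)      ≡⟨ grow-+ i 0 _ _ ⟩
    D i m + D i (suc m)                                               ∎
    where
      step : ∀ b → b * completions m b 0 + completions m (suc b) 0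
                   ≡ completions m b 0 + completions (suc m) b 0
      step b = begin
        b * completions m b 0 + completions m (suc b) 0
          ≡⟨ cong (b * completions m b 0 +_) (sym (completions-settle m b 0)) ⟩
        b * completions m b 0 + (completions m b 1 + completions m b 0)
          ≡⟨ rotate (b * completions m b 0) (completions m b 1) (completions m b 0) ⟩
        completions m b 0 + (b * completions m b 0 + completions m b 1) ∎
        where rotate : ∀ x y z → x + (y + z) ≡ z + (x + y)
              rotate = solve-∀

  length-rgs : ∀ m b → length (rgs m b) ≡ grow m b (λ _ → 1)
  length-rgs zero    b = refl
  length-rgs (suc m) b = begin
    length (rgs (suc m) b)
      ≡⟨ sym (countB-all (rgs (suc m) b)) ⟩
    countB (λ _ → true) (rgs (suc m) b)
      ≡⟨ countB-rgs (λ _ → true) m b ⟩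
    ∑< b (λ l → countB (λ _ → true) (rgs m (nextBound l b))) + countB (λ _ → true) (rgs m (nextBound b b))
      ≡⟨ cong₂ _+_ (∑<-const b _ (λ l l<b → trans (size (nextBound l b))
                                                   (cong grow-1 (nextBound-old l<b))))
                   (trans (size (nextBound b b)) (cong grow-1 (nextBound-new b))) ⟩
    b * grow-1 b + grow-1 (suc b) ∎
    where
      grow-1 = λ c → grow m c (λ _ → 1)
      size : ∀ c → countB (λ _ → true) (rgs m c) ≡ grow-1 c
      size c = trans (countB-all (rgs m c)) (length-rgs m c)

  D-zero : ∀ i → D i 0 ≡ Bell i
  D-zero i = sym (length-rgs i 0)

  occ : List ℕ → ℕ → ℕ
  occ w x = countB (λ y → y ≡ᵇ x) w

  occ-∷ : ∀ y w x → occ (y ∷ w) x ≡ toℕ (y ≡ᵇ x) + occ w x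
  occ-∷ y w x = countB-∷ (λ y → y ≡ᵇ x) y w

  occ-labelOf : ∀ w j → j < length w → 1 ≤ occ w (labelOf w j)
  occ-labelOf (y ∷ w) zero    _ rewrite occ-∷ y w y | ≡ᵇ-refl y = s≤s z≤n
  occ-labelOf (y ∷ w) (suc j) (s≤s j<) rewrite occ-∷ y w (labelOf w j) =
    ≤-trans (occ-labelOf w j j<) (m≤n+m _ (toℕ (y ≡ᵇ labelOf w j)))

  occ-position : ∀ w x → 1 ≤ occ w x → ∃ λ j → j < length w × labelOf w j ≡ x
  occ-position (y ∷ w) x occ≥1 with y ≡ᵇ x in y≡x
  ... | true  = 0 , s≤s z≤n , ≡ᵇ-sound y x y≡x
  ... | false with occ-position w x occ≥1
  ...   | j , j< , wj≡x = suc j , s≤s j< , wj≡x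

  repeat⇒occ≥2 : ∀ w {x j j′} → j < j′ → j′ < length w →
                 labelOf w j ≡ x → labelOf w j′ ≡ x → 2 ≤ occ w x
  repeat⇒occ≥2 (y ∷ w) {x} {zero}  {suc j′} _ (s≤s j′<) refl wj′≡y
    rewrite occ-∷ y w y | ≡ᵇ-refl y =
      s≤s (subst (λ z → 1 ≤ occ w z) wj′≡y (occ-labelOf w j′ j′<))
  repeat⇒occ≥2 (y ∷ w) {x} {suc j} {suc j′} (s≤s j<j′) (s≤s j′<) wj≡x wj′≡x
    rewrite occ-∷ y w x =
      ≤-trans (repeat⇒occ≥2 w j<j′ j′< wj≡x wj′≡x) (m≤n+m _ (toℕ (y ≡ᵇ x)))

  occ≡1⇒no-repeat : ∀ w {x j j′} → occ w x ≡ 1 → j < j′ → j′ < length w →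
                    labelOf w j ≡ x → labelOf w j′ ≡ x → ⊥
  occ≡1⇒no-repeat w occ≡1 j<j′ j′< wj≡x wj′≡x =
    <⇒≱ (s≤s (s≤s z≤n)) (subst (2 ≤_) occ≡1 (repeat⇒occ≥2 w j<j′ j′< wj≡x wj′≡x))

  labelOf-< : ∀ {b} w → IsRGS b w → ∀ {j} → j < length w → labelOf w j < b + length w
  labelOf-< {b} (l ∷ s) (l≤b , _) {zero} _ =
    ≤-trans (s≤s (≤-trans l≤b (m≤m+n b (length s)))) (≤-reflexive (sym (+-suc b (length s))))
  labelOf-< {b} (l ∷ s) (_ , rgs-s) {suc j} (s≤s j<) =
    ≤-trans (labelOf-< s rgs-s j<)
            (≤-trans (+-monoˡ-≤ (length s) (nextBound-≤ l b)) (≤-reflexive (sym (+-suc b (length s)))))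

  IsRGS-earlier : ∀ {b} w → IsRGS b w → ∀ {j y} → j < length w → b ≤ y → y < labelOf w j →
                  ∃ λ p → p < j × labelOf w p ≡ y
  IsRGS-earlier (l ∷ s) (l≤b , _) {zero} _ b≤y y<l = ⊥-elim (<⇒≱ y<l (≤-trans l≤b b≤y))
  IsRGS-earlier {b} (l ∷ s) (l≤b , rgs-s) {suc j} {y} (s≤s j<) b≤y y<x with m≤n⇒m<n∨m≡n l≤b
  ... | inj₁ l<b with IsRGS-earlier s rgs-s j< (subst (_≤ y) (sym (nextBound-old l<b)) b≤y) y<x
  ...   | p , p<j , sp≡y = suc p , s≤s p<j , sp≡y
  IsRGS-earlier {b} (l ∷ s) (l≤b , rgs-s) {suc j} {y} (s≤s j<) b≤y y<x | inj₂ refl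
    with m≤n⇒m<n∨m≡n b≤y
  ... | inj₂ refl = 0 , s≤s z≤n , refl
  ... | inj₁ b<y with IsRGS-earlier s rgs-s j< (subst (_≤ y) (sym (nextBound-new l)) b<y) y<x
  ...   | p , p<j , sp≡y = suc p , s≤s p<j , sp≡y

  pending : ℕ → List ℕ → ℕ → Bool
  pending K q x = (K <ᵇ x) ∧ (occ q x ≡ᵇ 1)

  largestSingletonLabelIs : ℕ → List ℕ → Bool
  largestSingletonLabelIs K w = (occ w K ≡ᵇ 1) ∧ (count< (length w) (pending K w) ≡ᵇ 0)

  -- Blocks are labelled in order of first occurrence, so a singleton position after k is the same
  -- as a singleton label above that of k.
  largestSingletonIs≡Label : ∀ w k → IsRGS 0 w → k < length w →
                            largestSingletonIs w k ≡ largestSingletonLabelIs (labelOf w k) w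
  largestSingletonIs≡Label w k rgs k<
    rewrite <ᵇ-true k< | countB-upTo (length w) (λ j → (k <ᵇ j) ∧ isSingleton w j)
    with occ w (labelOf w k) ≡ᵇ 1 in occK
  ... | false = refl
  ... | true  = ≡ᵇ0-cong (count<≡0-transfer (length w) _ _ label⇒position)
                         (count<≡0-transfer (length w) _ _ position⇒label)
    where
      K = labelOf w k
      occK≡1 = ≡ᵇ-sound _ 1 occK
      position⇒label : ∀ j → j < length w → ((k <ᵇ j) ∧ isSingleton w j) ≡ true →
                       ∃ λ x → x < length w × pending K w x ≡ true
      position⇒label j j< later-singleton with ∧-true (k <ᵇ j) _ later-singleton
      ... | k<ᵇj , singleton with ∧-true (j <ᵇ length w) _ singleton
      ...   | _ , occx = labelOf w j , labelOf-< w rgs j< , larger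
        where
          x = labelOf w j
          k<j = <ᵇ-sound k j k<ᵇj
          larger : pending K w x ≡ true
          larger with <-cmp x K
          ... | tri≈ _ x≡K _ = ⊥-elim (occ≡1⇒no-repeat w occK≡1 k<j j< refl x≡K)
          ... | tri< x<K _ _ with IsRGS-earlier w rgs k< z≤n x<K
          ...   | p , p<k , wp≡x =
            ⊥-elim (occ≡1⇒no-repeat w (≡ᵇ-sound _ 1 occx) (<-trans p<k k<j) j< wp≡x refl)
          larger | tri> _ _ K<x rewrite <ᵇ-true K<x | occx = refl
      label⇒position : ∀ x → x < length w → pending K w x ≡ true →
                       ∃ λ j → j < length w × ((k <ᵇ j) ∧ isSingleton w j) ≡ true
      label⇒position x x< larger with ∧-true (K <ᵇ x) _ larger
      ... | K<ᵇx , occx with occ-position w x (≤-reflexive (sym (≡ᵇ-sound _ 1 occx)))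
      ...   | j , j< , wj≡x = j , j< , later
        where
          K<x = <ᵇ-sound K x K<ᵇx
          later : ((k <ᵇ j) ∧ isSingleton w j) ≡ true
          later with <-cmp j k
          ... | tri≈ _ refl _ = ⊥-elim (<⇒≢ K<x wj≡x)
          ... | tri< j<k _ _ with IsRGS-earlier w rgs j< z≤n (subst (K <_) (sym wj≡x) K<x)
          ...   | p , p<j , wp≡K = ⊥-elim (occ≡1⇒no-repeat w occK≡1 (<-trans p<j j<k) k< wp≡K refl)
          later | tri> _ _ k<j rewrite <ᵇ-true k<j | <ᵇ-true j< | wj≡x | occx = refl

  occ-∷ʳ : ∀ q l x → occ (q ++ [ l ]) x ≡ occ q x + toℕ (l ≡ᵇ x)
  occ-∷ʳ q l x =
    trans (countB-++ (λ y → y ≡ᵇ x) q [ l ]) (cong (occ q x +_) (trans (occ-∷ l [] x) (+-identityʳ _)))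

  occ-∷ʳ-other : ∀ q {l x} → (l ≡ᵇ x) ≡ false → occ (q ++ [ l ]) x ≡ occ q x
  occ-∷ʳ-other q {l} {x} l≢ᵇx =
    trans (occ-∷ʳ q l x) (trans (cong (λ b → occ q x + toℕ b) l≢ᵇx) (+-identityʳ _))

  occ-∷ʳ-same : ∀ q l → occ (q ++ [ l ]) l ≡ suc (occ q l)
  occ-∷ʳ-same q l =
    trans (occ-∷ʳ q l l) (trans (cong (λ b → occ q l + toℕ b) (≡ᵇ-refl l)) (+-comm (occ q l) 1))

  length-∷ʳ : ∀ (q : List ℕ) l → length (q ++ [ l ]) ≡ suc (length q)
  length-∷ʳ q l = trans (length-++ q) (+-comm (length q) 1)

  record UsesLabels (q : List ℕ) (c : ℕ) : Set where
    field
      used   : ∀ x → x < c → 1 ≤ occ q x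
      unused : ∀ x → c ≤ x → occ q x ≡ 0
      bound  : c ≤ length q
  open UsesLabels

  UsesLabels-old : ∀ {q c l} → UsesLabels q c → l < c → UsesLabels (q ++ [ l ]) c
  UsesLabels-old {q} {c} {l} uses l<c = record
    { used   = λ x x<c → ≤-trans (used uses x x<c) (subst (occ q x ≤_) (sym (occ-∷ʳ q l x)) (m≤m+n _ _))
    ; unused = λ x c≤x → trans (occ-∷ʳ-other q (≢⇒≡ᵇ-false l x (<⇒≢ (<-≤-trans l<c c≤x)))) (unused uses x c≤x)
    ; bound  = ≤-trans (bound uses) (subst (length q ≤_) (sym (length-∷ʳ q l)) (n≤1+n _))
    }

  UsesLabels-new : ∀ {q c} → UsesLabels q c → UsesLabels (q ++ [ c ]) (suc c)
  UsesLabels-new {q} {c} uses = record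
    { used   = used′
    ; unused = λ x 1+c≤x → trans (occ-∷ʳ-other q (≢⇒≡ᵇ-false c x (<⇒≢ 1+c≤x)))
                                 (unused uses x (≤-trans (n≤1+n c) 1+c≤x))
    ; bound  = subst (suc c ≤_) (sym (length-∷ʳ q c)) (s≤s (bound uses))
    }
    where
      used′ : ∀ x → x < suc c → 1 ≤ occ (q ++ [ c ]) x
      used′ x (s≤s x≤c) with m≤n⇒m<n∨m≡n x≤c
      ... | inj₁ x<c  = ≤-trans (used uses x x<c) (subst (occ q x ≤_) (sym (occ-∷ʳ q c x)) (m≤m+n _ _))
      ... | inj₂ refl = subst (1 ≤_) (sym (occ-∷ʳ-same q x)) (s≤s z≤n)

  UsesLabels-∷ʳ : ∀ {q c l} → UsesLabels q c → l ≤ c → UsesLabels (q ++ [ l ]) (nextBound l c)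
  UsesLabels-∷ʳ {q} {c} {l} uses l≤c with m≤n⇒m<n∨m≡n l≤c
  ... | inj₁ l<c  rewrite nextBound-old l<c = UsesLabels-old uses l<c
  ... | inj₂ refl rewrite nextBound-new l   = UsesLabels-new uses

  occ≥2⇒¬largestSingletonLabel : ∀ K q s → 2 ≤ occ q K → largestSingletonLabelIs K (q ++ s) ≡ false
  occ≥2⇒¬largestSingletonLabel K q s occ≥2
    rewrite ≥2⇒≡ᵇ1-false (subst (2 ≤_) (sym (countB-++ (λ y → y ≡ᵇ K) q s))
                                (≤-trans occ≥2 (m≤m+n _ _))) = refl

  pending-∷ʳ-other : ∀ K q {l x} → x ≢ l → pending K (q ++ [ l ]) x ≡ pending K q x
  pending-∷ʳ-other K q {l} {x} x≢l
    rewrite occ-∷ʳ-other q {l} {x} (≢⇒≡ᵇ-false l x (λ l≡x → x≢l (sym l≡x))) = refl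

  pending-∷ʳ-old : ∀ K {q c l} → UsesLabels q c → l < c → pending K (q ++ [ l ]) l ≡ false
  pending-∷ʳ-old K {q} {c} {l} uses l<c
    rewrite occ-∷ʳ-same q l | ≥2⇒≡ᵇ1-false (s≤s (used uses l l<c)) = ∧-zeroʳ (K <ᵇ l)

  count<-pending-∷ʳ : ∀ K {q c l} → UsesLabels q c → l < c →
                      count< c (pending K (q ++ [ l ])) + toℕ (pending K q l) ≡ count< c (pending K q)
  count<-pending-∷ʳ K {q} {c} {l} uses l<c = begin
    count< c (pending K (q ++ [ l ])) + toℕ (pending K q l)
      ≡⟨ ∑<-update c l _ _ l<c (λ x _ x≢l → cong toℕ (pending-∷ʳ-other K q x≢l)) ⟩
    count< c (pending K q) + toℕ (pending K (q ++ [ l ]) l)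
      ≡⟨ cong (λ b → count< c (pending K q) + toℕ b) (pending-∷ʳ-old K uses l<c) ⟩
    count< c (pending K q) + 0
      ≡⟨ +-identityʳ _ ⟩
    count< c (pending K q) ∎

  pending-new : ∀ K {q c u} → UsesLabels q c → K < c → count< c (pending K q) ≡ u →
                count< (suc c) (pending K (q ++ [ c ])) ≡ suc u
  pending-new K {q} {c} {u} uses K<c pend≡u = begin
    count< c (pending K (q ++ [ c ])) + toℕ (pending K (q ++ [ c ]) c)
      ≡⟨ cong₂ _+_ (∑<-cong c (λ x x<c → cong toℕ (pending-∷ʳ-other K q (<⇒≢ x<c))))
                     (cong toℕ newly-pending) ⟩
    count< c (pending K q) + 1
      ≡⟨ trans (cong (_+ 1) pend≡u) (+-comm u 1) ⟩
    suc u ∎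
    where newly-pending : pending K (q ++ [ c ]) c ≡ true
          newly-pending rewrite <ᵇ-true K<c | occ-∷ʳ-same q c | unused uses c ≤-refl = refl

  largestSingletonLabel-complete : ∀ {K q c} → UsesLabels q c → occ q K ≡ 1 →
                                  largestSingletonLabelIs K q ≡ (count< c (pending K q) ≡ᵇ 0)
  largestSingletonLabel-complete {K} {q} {c} uses occK≡1 rewrite occK≡1 = cong (_≡ᵇ 0) (begin
    count< (length q) (pending K q)
      ≡⟨ cong (λ n → count< n (pending K q)) (sym (m+[n∸m]≡n (bound uses))) ⟩
    count< (c + (length q ∸ c)) (pending K q)
      ≡⟨ ∑<-extend c (length q ∸ c) _ absent ⟩
    count< c (pending K q) ∎)
    where absent : ∀ x → c ≤ x → toℕ (pending K q x) ≡ 0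
          absent x c≤x rewrite unused uses x c≤x with K <ᵇ x
          ... | true  = refl
          ... | false = refl

  -- The number of completions once one of the u pending labels is reused; the value for u = 0 is
  -- never used, since then no label is pending.
  completions-settled : ℕ → ℕ → ℕ → ℕ
  completions-settled m f zero    = 0
  completions-settled m f (suc u) = completions m (suc f) u

  mutual
    completions-after : ∀ m {K q c f u} → UsesLabels q c → K < c → occ q K ≡ 1 →
                        count< c (pending K q) ≡ u → suc (f + u) ≡ c →
                        countB (λ s → largestSingletonLabelIs K (q ++ s)) (rgs m c) ≡ completions m f u
    completions-after zero {K} {q} {c} {f} {u} uses K<c occK pend≡u c≡
      rewrite ++-identityʳ q | largestSingletonLabel-complete uses occK | pend≡u = base u
      where base : ∀ u → (if u ≡ᵇ 0 then 1 else 0) ≡ completions 0 f u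
            base zero    = refl
            base (suc u) = refl
    completions-after (suc m) {K} {q} {c} {f} {u} uses K<c occK pend≡u c≡ = begin
      countB P (rgs (suc m) c)
        ≡⟨ countB-rgs P m c ⟩
      ∑< c (λ l → countB (λ s → P (l ∷ s)) (rgs m (nextBound l c)))
        + countB (λ s → P (c ∷ s)) (rgs m (nextBound c c))
        ≡⟨ cong₂ _+_ (∑<-cong c old) new ⟩
      ∑< c (λ l → toℕ (other l) * α + toℕ (settled l) * β) + completions m f (suc u)
        ≡⟨ cong (_+ completions m f (suc u))
                (trans (∑<-+ c _ _) (cong₂ _+_ (∑<-*ʳ c _ α) (∑<-*ʳ c _ β))) ⟩
      count< c other * α + count< c settled * β + completions m f (suc u)
        ≡⟨ cong₂ (λ a b → a * α + b * β + completions m f (suc u)) other≡u settled≡f ⟩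
      u * α + f * β + completions m f (suc u)
        ≡⟨ recurrence u ⟩
      completions (suc m) f u ∎
      where
        P = λ s → largestSingletonLabelIs K (q ++ s)
        α = completions-settled m f u
        β = completions m f u
        other   = λ l → not (l ≡ᵇ K) ∧ pending K q l
        settled = λ l → not (l ≡ᵇ K) ∧ not (pending K q l)
        P-∷ : ∀ l s → P (l ∷ s) ≡ largestSingletonLabelIs K ((q ++ [ l ]) ++ s)
        P-∷ l s = cong (largestSingletonLabelIs K) (sym (++-assoc q [ l ] s))
        old : ∀ l → l < c → countB (λ s → P (l ∷ s)) (rgs m (nextBound l c))
                             ≡ toℕ (other l) * α + toℕ (settled l) * β
        old l l<c rewrite nextBound-old l<c = begin
          countB (λ s → P (l ∷ s)) (rgs m c)
            ≡⟨ countB-cong (rgs m c) (P-∷ l) ⟩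
          countB (λ s → largestSingletonLabelIs K ((q ++ [ l ]) ++ s)) (rgs m c)
            ≡⟨ completions-after-old m uses K<c occK pend≡u c≡ l<c ⟩
          (if l ≡ᵇ K then 0 else if pending K q l then α else β)
            ≡⟨ classify (l ≡ᵇ K) (pending K q l) α β ⟩
          toℕ (other l) * α + toℕ (settled l) * β ∎
        new : countB (λ s → P (c ∷ s)) (rgs m (nextBound c c)) ≡ completions m f (suc u)
        new rewrite nextBound-new c =
          trans (countB-cong (rgs m (suc c)) (P-∷ c))
                (completions-after m (UsesLabels-new uses) (m≤n⇒m≤1+n K<c)
                   (trans (occ-∷ʳ-other q (≢⇒≡ᵇ-false c K (λ c≡K → <⇒≢ K<c (sym c≡K)))) occK)
                   (pending-new K uses K<c pend≡u) (cong suc (trans (+-suc f u) c≡)))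
        K-not-pending : pending K q K ≡ false
        K-not-pending rewrite <ᵇ-false {K} {K} ≤-refl = refl
        other≡u : count< c other ≡ u
        other≡u = trans (count<-≢-∧ c K (pending K q) K-not-pending) pend≡u
        settled≡f : count< c settled ≡ f
        settled≡f = +-cancelˡ-≡ u _ _ (suc-injective (begin
          suc (u + count< c settled) ≡⟨ cong (λ v → suc (v + count< c settled)) (sym pend≡u) ⟩
          suc (count< c (pending K q) + count< c settled)
            ≡⟨ count<-≢-∧-not c K (pending K q) K<c K-not-pending ⟩
          c ≡⟨ sym c≡ ⟩
          suc (f + u) ≡⟨ cong suc (+-comm f u) ⟩
          suc (u + f) ∎))
        recurrence : ∀ u → u * completions-settled m f u + f * completions m f u + completions m f (suc u)
                           ≡ completions (suc m) f u
        recurrence zero     = refl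
        recurrence (suc u′) =
          cong (_+ completions m f (2 + u′))
               (+-comm (suc u′ * completions m (suc f) u′) (f * completions m f (suc u′)))

    completions-after-old : ∀ m {K q c f u l} → UsesLabels q c → K < c → occ q K ≡ 1 →
                            count< c (pending K q) ≡ u → suc (f + u) ≡ c → l < c →
                            countB (λ s → largestSingletonLabelIs K ((q ++ [ l ]) ++ s)) (rgs m c)
                              ≡ (if l ≡ᵇ K then 0
                                 else if pending K q l then completions-settled m f u else completions m f u)
    completions-after-old m {K} {q} {c} {f} {u} {l} uses K<c occK pend≡u c≡ l<c with l ≡ᵇ K in l≡ᵇK
    ... | true = countB-none _ (rgs m c) (λ s → occ≥2⇒¬largestSingletonLabel K (q ++ [ l ]) s occ≥2)
      where occ≥2 : 2 ≤ occ (q ++ [ l ]) K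
            occ≥2 rewrite ≡ᵇ-sound l K l≡ᵇK | occ-∷ʳ-same q K | occK = ≤-refl
    ... | false with pending K q l in pl
    ...   | true  = subst (λ v → countB (λ s → largestSingletonLabelIs K ((q ++ [ l ]) ++ s)) (rgs m c)
                                   ≡ completions-settled m f v)
                          (sym u≡1+u′)
                          (completions-after m (UsesLabels-old uses l<c) K<c occK′ refl c≡′)
      where
        occK′ = trans (occ-∷ʳ-other q l≡ᵇK) occK
        u′ = count< c (pending K (q ++ [ l ]))
        u≡1+u′ : u ≡ suc u′
        u≡1+u′ = begin
          u                                 ≡⟨ sym pend≡u ⟩
          count< c (pending K q)            ≡⟨ sym (count<-pending-∷ʳ K uses l<c) ⟩
          u′ + toℕ (pending K q l)          ≡⟨ cong (λ b → u′ + toℕ b) pl ⟩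
          u′ + 1                            ≡⟨ +-comm u′ 1 ⟩
          suc u′                            ∎
        c≡′ : suc (suc f + u′) ≡ c
        c≡′ = trans (cong suc (sym (+-suc f u′))) (trans (cong (λ v → suc (f + v)) (sym u≡1+u′)) c≡)
    ...   | false =
      completions-after m (UsesLabels-old uses l<c) K<c (trans (occ-∷ʳ-other q l≡ᵇK) occK) u′≡u c≡
      where
        u′≡u : count< c (pending K (q ++ [ l ])) ≡ u
        u′≡u = begin
          count< c (pending K (q ++ [ l ]))                           ≡⟨ sym (+-identityʳ _) ⟩
          count< c (pending K (q ++ [ l ])) + 0
            ≡⟨ cong (λ b → count< c (pending K (q ++ [ l ])) + toℕ b) (sym pl) ⟩
          count< c (pending K (q ++ [ l ])) + toℕ (pending K q l)     ≡⟨ count<-pending-∷ʳ K uses l<c ⟩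
          count< c (pending K q)                                      ≡⟨ pend≡u ⟩
          u ∎

  labelOf-++ : ∀ (q : List ℕ) ys → labelOf (q ++ ys) (length q) ≡ labelOf ys 0
  labelOf-++ []      ys = refl
  labelOf-++ (x ∷ q) ys = labelOf-++ q ys

  completions-before : ∀ j m {k q c} → UsesLabels q c → length q + j ≡ k →
                       countB (λ s → largestSingletonLabelIs (labelOf (q ++ s) k) (q ++ s)) (rgs (j + suc m) c)
                         ≡ grow j c (λ b → completions m b 0)
  completions-before zero m {k} {q} {c} uses |q|≡k = begin
    countB P (rgs (suc m) c)
      ≡⟨ countB-rgs P m c ⟩
    ∑< c (λ l → countB (λ s → P (l ∷ s)) (rgs m (nextBound l c)))
      + countB (λ s → P (c ∷ s)) (rgs m (nextBound c c))
      ≡⟨ cong₂ _+_ (trans (∑<-const c 0 repeated) (*-zeroʳ c)) new ⟩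
    completions m c 0 ∎
    where
      P = λ s → largestSingletonLabelIs (labelOf (q ++ s) k) (q ++ s)
      P-∷ : ∀ l s → P (l ∷ s) ≡ largestSingletonLabelIs l ((q ++ [ l ]) ++ s)
      P-∷ l s rewrite sym |q|≡k | +-identityʳ (length q) | labelOf-++ q (l ∷ s) =
        cong (largestSingletonLabelIs l) (sym (++-assoc q [ l ] s))
      repeated : ∀ l → l < c → countB (λ s → P (l ∷ s)) (rgs m (nextBound l c)) ≡ 0
      repeated l l<c = countB-none _ (rgs m (nextBound l c))
        (λ s → trans (P-∷ l s) (occ≥2⇒¬largestSingletonLabel l (q ++ [ l ]) s
                                 (subst (2 ≤_) (sym (occ-∷ʳ-same q l)) (s≤s (used uses l l<c)))))
      none-pending : count< (suc c) (pending c (q ++ [ c ])) ≡ 0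
      none-pending = count<-none (suc c) _ above-c
        where above-c : ∀ x → x < suc c → pending c (q ++ [ c ]) x ≡ false
              above-c x (s≤s x≤c) rewrite <ᵇ-false x≤c = refl
      new : countB (λ s → P (c ∷ s)) (rgs m (nextBound c c)) ≡ completions m c 0
      new rewrite nextBound-new c =
        trans (countB-cong (rgs m (suc c)) (P-∷ c))
              (completions-after m (UsesLabels-new uses) ≤-refl
                 (trans (occ-∷ʳ-same q c) (cong suc (unused uses c ≤-refl))) none-pending
                 (cong suc (+-identityʳ c)))
  completions-before (suc j) m {k} {q} {c} uses |q|≡k = begin
    countB P (rgs (suc (j + suc m)) c)
      ≡⟨ countB-rgs P (j + suc m) c ⟩
    ∑< c (λ l → countB (λ s → P (l ∷ s)) (rgs (j + suc m) (nextBound l c)))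
      + countB (λ s → P (c ∷ s)) (rgs (j + suc m) (nextBound c c))
      ≡⟨ cong₂ _+_ (∑<-const c _ old) new ⟩
    c * grow j c h + grow j (suc c) h ∎
    where
      P = λ s → largestSingletonLabelIs (labelOf (q ++ s) k) (q ++ s)
      h = λ b → completions m b 0
      branch : ∀ l → l ≤ c → countB (λ s → P (l ∷ s)) (rgs (j + suc m) (nextBound l c))
                            ≡ grow j (nextBound l c) h
      branch l l≤c =
        trans (countB-cong (rgs (j + suc m) (nextBound l c))
                           (λ s → cong (λ w → largestSingletonLabelIs (labelOf w k) w)
                                       (sym (++-assoc q [ l ] s))))
              (completions-before j m (UsesLabels-∷ʳ uses l≤c)
                 (trans (cong (_+ j) (length-∷ʳ q l)) (trans (sym (+-suc (length q) j)) |q|≡k)))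
      old : ∀ l → l < c → countB (λ s → P (l ∷ s)) (rgs (j + suc m) (nextBound l c)) ≡ grow j c h
      old l l<c = trans (branch l (<⇒≤ l<c)) (cong (λ b → grow j b h) (nextBound-old l<c))
      new : countB (λ s → P (c ∷ s)) (rgs (j + suc m) (nextBound c c)) ≡ grow j (suc c) h
      new = trans (branch c ≤-refl) (cong (λ b → grow j b h) (nextBound-new c))

  A-table : ∀ k m → A (k + m) k ≡ D k m
  A-table k m = begin
    countB (λ v → largestSingletonIs v k) (rgs (suc (k + m)) 0)
      ≡⟨ countB-rgs-cong (suc (k + m)) 0 by-label ⟩
    countB P (rgs (suc (k + m)) 0)
      ≡⟨ cong (λ n → countB P (rgs n 0)) (sym (+-suc k m)) ⟩
    countB P (rgs (k + suc m) 0)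
      ≡⟨ completions-before k m no-labels refl ⟩
    D k m ∎
    where
      P = λ v → largestSingletonLabelIs (labelOf v k) v
      by-label : ∀ w → IsRGS 0 w → length w ≡ suc (k + m) → largestSingletonIs w k ≡ P w
      by-label w rgs-w |w| = largestSingletonIs≡Label w k rgs-w (subst (k <_) (sym |w|) (s≤s (m≤m+n k m)))
      no-labels : UsesLabels [] 0
      no-labels = record { used = λ _ () ; unused = λ _ _ → refl ; bound = z≤n }

open import Defs
open import Data.Nat using (ℕ; suc; _∸_; _≤_)
import Data.Nat as ℕ
open import Data.Nat.Properties using (m≤n⇒∃[o]m+o≡n; m+[n∸m]≡n; +-assoc)
open import Data.Nat.Combinatorics using (_C_)
open import Data.Integer using (ℤ; +_; _*_)
open import Data.Integer.Properties using (pos-*)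
open import Data.Product using (_×_; _,_)
open import Relation.Binary.PropositionalEquality using (_≡_; refl; sym; trans; cong; module ≡-Reasoning)
open ≡-Reasoning
open Transforms using (∑; Δ^; Δ^-cong; ∑-sgn-C-C≡C*Δ^; BellPoly-transform; module DifferenceTable)
open RestrictedGrowth using (D; D-zero; D-suc; A-table)
open DifferenceTable Bell D D-zero D-suc using (Δ^-row; Δ^-antidiagonal)

A-inversion : ∀ n i → i ≤ n →
              ∑ n (λ k → sgn (n ∸ k) * + ((n C k) ℕ.* A n k) * + (k C i)) ≡ + ((n C i) ℕ.* Bell i)
A-inversion n i i≤n with m≤n⇒∃[o]m+o≡n i≤n
... | m , refl = begin
  _
    ≡⟨ ∑-sgn-C-C≡C*Δ^ i m (A (i ℕ.+ m)) ⟩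
  + ((i ℕ.+ m) C i) * Δ^ m (λ t → + A (i ℕ.+ m) (i ℕ.+ t))
    ≡⟨ cong (+ ((i ℕ.+ m) C i) *_) (Δ^-cong m (λ t t≤m → cong +_ (antidiagonal t≤m))) ⟩
  + ((i ℕ.+ m) C i) * Δ^ m (λ t → + D (i ℕ.+ t) (0 ℕ.+ (m ∸ t)))
    ≡⟨ cong (+ ((i ℕ.+ m) C i) *_) (Δ^-antidiagonal m 0 i) ⟩
  + ((i ℕ.+ m) C i) * + D i 0
    ≡⟨ cong (λ z → + ((i ℕ.+ m) C i) * + z) (D-zero i) ⟩
  + ((i ℕ.+ m) C i) * + Bell i
    ≡⟨ sym (pos-* ((i ℕ.+ m) C i) (Bell i)) ⟩
  + (((i ℕ.+ m) C i) ℕ.* Bell i) ∎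
  where antidiagonal : ∀ {t} → t ≤ m → A (i ℕ.+ m) (i ℕ.+ t) ≡ D (i ℕ.+ t) (m ∸ t)
        antidiagonal {t} t≤m =
          trans (cong (λ n → A n (i ℕ.+ t)) (trans (cong (i ℕ.+_) (sym (m+[n∸m]≡n t≤m)))
                                                  (sym (+-assoc i t (m ∸ t)))))
                (A-table (i ℕ.+ t) (m ∸ t))

Bell-inversion : ∀ n i → i ≤ n →
                 ∑ n (λ k → sgn (n ∸ k) * + ((n C k) ℕ.* Bell k) * + (k C i)) ≡ + ((n C i) ℕ.* A n i)
Bell-inversion n i i≤n with m≤n⇒∃[o]m+o≡n i≤n
... | m , refl = begin
  _
    ≡⟨ ∑-sgn-C-C≡C*Δ^ i m Bell ⟩
  + ((i ℕ.+ m) C i) * Δ^ m (λ t → + Bell (i ℕ.+ t))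
    ≡⟨ cong (+ ((i ℕ.+ m) C i) *_) (Δ^-row m i) ⟩
  + ((i ℕ.+ m) C i) * + D i m
    ≡⟨ cong (λ z → + ((i ℕ.+ m) C i) * + z) (sym (A-table i m)) ⟩
  + ((i ℕ.+ m) C i) * + A (i ℕ.+ m) i
    ≡⟨ sym (pos-* ((i ℕ.+ m) C i) (A (i ℕ.+ m) i)) ⟩
  + (((i ℕ.+ m) C i) ℕ.* A (i ℕ.+ m) i) ∎

corollary3p3 : (n : ℕ) →
    (sumP n (λ k → scale (sgn (n ∸ k) * + ((n C k) Data.Nat.* A n k)) (BellPoly (suc k)))
    ≈P yTimes (sumP n (λ k → scale (+ ((n C k) Data.Nat.* Bell k)) (BellPoly k))))
    ×
    (sumP n (λ k → scale (sgn (n ∸ k) * + ((n C k) Data.Nat.* Bell k)) (BellPoly (suc k)))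
    ≈P yTimes (sumP n (λ k → scale (+ ((n C k) Data.Nat.* A n k)) (BellPoly k))))
corollary3p3 n =
  BellPoly-transform n (signed (A n)) (weighted Bell) (A-inversion n) ,
  BellPoly-transform n (signed Bell) (weighted (A n)) (Bell-inversion n)
  where
    signed weighted : (ℕ → ℕ) → ℕ → ℤ
    signed   x k = sgn (n ∸ k) * + ((n C k) ℕ.* x k)
    weighted x k = + ((n C k) ℕ.* x k)
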